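{- Let $T_n$ be the number of $p_2$-configurations $C$ on the path $P_n$ with $|v_1|^C=0$ (equivalently, the number of $p_2$-configurations on $P_n$ up to adding a common integer constant to all stack sizes). Then $T_1=0$, $T_2=2$, $T_3=8$, $T_4=26$, and for all $n\ge 5$, $$T_n = 3T_{n-1}+2T_{n-2}+T_{n-3}-T_{n-4}.$$
   Context: Parallel Diffusion on a finite simple graph $G$: a configuration assigns an integer stack size $|v|$ (possibly negative) to each vertex. In one step all vertices fire simultaneously: each vertex sends one chip to each neighbour with strictly smaller stack size, so the new stack size of $v$ is $|v|+\#\{u\sim v:|u|>|v|\}-\#\{u\sim v:|u|<|v|\}$. Starting from $C_0$, $C_{t+1}$ is obtained from $C_t$ by one step. A configuration $D$ is a $p_2$-configuration if there are $C_0$ and $N$ such that $C_{t+2}=C_t$ and $C_{t+1}\ne C_t$ for all $t\ge N$, and $D=C_t$ for some $t\ge N$ (equivalently, starting from $D$ one has $D_2=D\ne D_1$). The path $P_n$ has vertices $v_1,\dots,v_n$ and edges $v_iv_{i+1}$. -}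

module Defs where

open import Data.Nat using (ℕ; zero; suc; _≤_)
open import Data.Nat.Properties using (_≟_)
open import Data.Integer as ℤ using (ℤ; +_; _+_; _-_; _<_; _<?_)
open import Data.Fin using (Fin; toℕ)
open import Data.Bool using (Bool; true; false; if_then_else_)
open import Data.Vec using (Vec; lookup; tabulate; head)
open import Data.List using (List; foldr; map; length)
open import Data.List.Relation.Unary.All using (All)
open import Data.List.Relation.Unary.Unique.Propositional using (Unique)
open import Data.List.Membership.Propositional using (_∈_)
open import Data.List using () renaming (_∷_ to _∷ₗ_)
open import Data.Fin using () renaming (zero to fzero)
open import Data.Product using (Σ; _×_; _,_)
open import Data.Sum using (_⊎_)
open import Relation.Nullary using (¬_; yes; no)
open import Relation.Nullary.Decidable using (⌊_⌋)
open import Relation.Binary.PropositionalEquality using (_≡_; _≢_)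
open import Data.List using (allFin)
open import Data.Bool using (_∨_)
open import Data.Bool.Properties using (∨-comm)
open import Data.Empty using (⊥-elim)
open import Data.Nat.Properties using (n<1+n; <-irrefl)
open import Relation.Binary.PropositionalEquality using (refl)

record Graph (n : ℕ) : Set where
  field
    adj     : Fin n → Fin n → Bool
    adj-sym : ∀ u v → adj u v ≡ adj v u
    adj-irr : ∀ v → adj v v ≡ false
open Graph public

-- A configuration assigns an integer stack size to each vertex.
Config : ℕ → Set
Config n = Vec ℤ n

-- Net chips received by a vertex with stack a from a neighbour with stack b:
-- +1 if b > a, -1 if b < a, 0 otherwise.
flow : ℤ → ℤ → ℤ
flow a b with a <? b | b <? a
... | yes _ | _     = + 1
... | no _  | yes _ = ℤ.- (+ 1)
... | no _  | no _  = + 0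

step : ∀ {n} → Graph n → Config n → Config n
step {n} G C = tabulate λ v →
  lookup C v + foldr _+_ (+ 0)
    (map (λ u → if adj G v u then flow (lookup C v) (lookup C u) else + 0) (allFin n))

IsP2 : ∀ {n} → Graph n → Config n → Set
IsP2 G D = (step G (step G D) ≡ D) × (step G D ≢ D)

-- The path P_n : vertices v₁,…,vₙ (here indices 0,…,n-1), edges v_i v_{i+1}.
pathAdj : ∀ {n} → Fin n → Fin n → Bool
pathAdj u v = ⌊ toℕ v ≟ suc (toℕ u) ⌋ ∨ ⌊ toℕ u ≟ suc (toℕ v) ⌋

pathAdj-sym : ∀ {n} (u v : Fin n) → pathAdj u v ≡ pathAdj v u
pathAdj-sym u v = ∨-comm ⌊ toℕ v ≟ suc (toℕ u) ⌋ ⌊ toℕ u ≟ suc (toℕ v) ⌋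

private
  noSelf : ∀ m → ⌊ m ≟ suc m ⌋ ≡ false
  noSelf m with m ≟ suc m
  ... | yes p = ⊥-elim (<-irrefl p (n<1+n m))
  ... | no _  = refl

pathAdj-irr : ∀ {n} (v : Fin n) → pathAdj v v ≡ false
pathAdj-irr v rewrite noSelf (toℕ v) = refl

P : (n : ℕ) → Graph n
P n = record { adj = pathAdj ; adj-sym = pathAdj-sym ; adj-irr = pathAdj-irr }

-- "k is the number of p₂-configurations C on P_{m+1} with |v₁|^C = 0":
-- there is a duplicate-free list of exactly k configurations which consists
-- of such configurations and contains every such configuration.
CountP2 : (m k : ℕ) → Set
CountP2 m k = Σ (List (Config (suc m))) λ L →
  Unique L
  × All (λ C → IsP2 (P (suc m)) C × head C ≡ + 0) L
  × (∀ C → IsP2 (P (suc m)) C → head C ≡ + 0 → C ∈ L)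
  × length L ≡ k

module Submission where

-- On a path write σᵢ ∈ {-1, 0, 1} for the sign of |vᵢ₊₁| - |vᵢ|, with σ = 0 beyond the ends.
-- One step adds σᵢ - σᵢ₋₁ to |vᵢ|, so a configuration returns after two steps iff the first
-- step negates every σᵢ, and it moves at all iff σ₁ ≠ 0.  Whether edge i flips depends only
-- on its difference dᵢ and on σᵢ₋₁, σᵢ₊₁, and forces |dᵢ| ≤ 3, so the p₂-configurations with
-- |v₁| = 0 are generated edge by edge and counted by a transfer matrix on pairs of consecutive
-- signs.  Adding each state to its mirror image (all signs negated) leaves four quantities
-- u, c, b, d with u′ = c + 2d, c′ = u, b′ = d, d′ = b + 2c + 3d and T (k + 2) = u k;
-- eliminating c, b and d gives the recurrence.

open import Defs
open import Data.Nat using (ℕ; suc; _≤_)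
open import Data.Integer using (ℤ; +_; _+_; _-_; _*_)
open import Data.Product using (Σ; _×_)
open import Relation.Binary.PropositionalEquality using (_≡_)

open import Data.Bool using (false; if_then_else_; _∨_)
open import Data.Empty using (⊥-elim)
open import Data.Fin as Fin using (Fin; toℕ)
open import Data.Integer using (-[1+_]; +[1+_]; -_; _<_; _<?_; +<+; -<+; +≤+; -≤-; -≤+)
  renaming (_≤_ to _≤ᶻ_)
import Data.Integer.Properties as ℤ
open import Algebra.Properties.Monoid.Sum ℤ.+-0-monoid using (sum-cong-≗; sum-replicate-zero) renaming (sum to ∑)
open import Data.Integer.Tactic.RingSolver using (solve-∀)
open import Data.List as List using (List; []; _∷_; foldr; map; allFin; filter; concatMap; length; _++_)
import Data.List.Properties as List
open import Data.List.Membership.Propositional using (_∈_; find; lose)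
open import Data.List.Membership.Propositional.Properties
  using (∈-filter⁺; ∈-filter⁻; ∈-concatMap⁻; ∈-concatMap⁺; ∈-map⁻; ∈-map⁺; ∈-++⁻; ∈-++⁺ˡ; ∈-++⁺ʳ)
open import Data.List.Relation.Unary.All as All using (All; []; _∷_)
open import Data.List.Relation.Unary.AllPairs using ([]; _∷_)
open import Data.List.Relation.Unary.Any using (here; there)
open import Data.List.Relation.Unary.Unique.Propositional using (Unique)
import Data.List.Relation.Unary.Unique.Propositional.Properties as Unique
open import Data.List.Relation.Unary.Unique.DecPropositional ℤ._≟_ using (unique?)
open import Data.Nat using (zero)
import Data.Nat as ℕ
import Data.Nat.Properties as ℕ
open import Data.Nat.ListAction using (sum)
open import Data.Nat.Tactic.RingSolver using () renaming (solve-∀ to ℕ-solve-∀)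
open import Data.Product using (_,_; proj₁; proj₂; ∃)
open import Data.Sum using ([_,_]′)
open import Data.Unit using (⊤; tt)
open import Data.Vec as Vec using (Vec; []; _∷_; lookup; tabulate; head)
import Data.Vec.Properties as Vec
open import Function using (_∘_)
open import Function.Bundles using (_⇔_; mk⇔; Equivalence)
open import Relation.Binary.Definitions using (DecidableEquality)
open import Relation.Binary.PropositionalEquality
  using (_≢_; refl; sym; trans; cong; cong₂; subst; module ≡-Reasoning)
open import Relation.Nullary using (¬_; yes; no)
open import Relation.Nullary.Decidable using (⌊_⌋; dec-false; from-yes; _×-dec_)
open import Relation.Unary using (Decidable)

+-sub-cancel : ∀ c d → c + d - c ≡ d
+-sub-cancel = solve-∀

+-sub-inverse : ∀ x y → x + (y - x) ≡ y
+-sub-inverse = solve-∀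

x+a≡x⇒a≡0 : ∀ x a → x + a ≡ x → a ≡ + 0
x+a≡x⇒a≡0 x a e = trans (sym (+-sub-cancel x a)) (trans (cong (_- x) e) (ℤ.+-inverseʳ x))

≟-suc : ∀ m n → ⌊ suc m ℕ.≟ suc n ⌋ ≡ ⌊ m ℕ.≟ n ⌋
≟-suc m n with m ℕ.≟ n | suc m ℕ.≟ suc n
... | yes _   | yes _ = refl
... | no _    | no _  = refl
... | yes m≡n | no ≢  = ⊥-elim (≢ (cong suc m≡n))
... | no m≢n  | yes e = ⊥-elim (m≢n (ℕ.suc-injective e))

unique-concatMap : ∀ {A B : Set} {f : A → List B} (key : B → A) {xs : List A} → Unique xs →
  (∀ a → Unique (f a)) → (∀ {a b} → b ∈ f a → key b ≡ a) → Unique (concatMap f xs)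
unique-concatMap key []          _       _      = []
unique-concatMap {f = f} key {a ∷ xs} (a∉xs ∷ xs!) f-unique f-key =
  Unique.++⁺ (f-unique a) (unique-concatMap key xs! f-unique f-key) disjoint
  where
  disjoint : ∀ {b} → ¬ (b ∈ f a × b ∈ concatMap f xs)
  disjoint (b∈fa , b∈rest) with find (∈-concatMap⁻ f {xs = xs} b∈rest)
  ... | a′ , a′∈xs , b∈fa′ = All.lookup a∉xs a′∈xs (trans (sym (f-key b∈fa)) (f-key b∈fa′))

length-concatMap : ∀ {A B : Set} (f : A → List B) xs → length (concatMap f xs) ≡ sum (map (length ∘ f) xs)
length-concatMap f []       = refl
length-concatMap f (x ∷ xs) = trans (List.length-++ (f x)) (cong (length (f x) ℕ.+_) (length-concatMap f xs))

sum-map-const : ∀ {A : Set} {f : A → ℕ} {n} xs → (∀ x → f x ≡ n) → sum (map f xs) ≡ length xs ℕ.* n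
sum-map-const []       _  = refl
sum-map-const (x ∷ xs) fn = cong₂ ℕ._+_ (fn x) (sum-map-const xs fn)

-- Signs

data Sgn : Set where
  neg zer pos : Sgn

⟦_⟧ : Sgn → ℤ
⟦ neg ⟧ = -[1+ 0 ]
⟦ zer ⟧ = + 0
⟦ pos ⟧ = + 1

opp : Sgn → Sgn
opp neg = pos
opp zer = zer
opp pos = neg

sgn : ℤ → Sgn
sgn (+ zero)  = zer
sgn +[1+ _ ]  = pos
sgn -[1+ _ ]  = neg

_≟ₛ_ : DecidableEquality Sgn
neg ≟ₛ neg = yes refl
zer ≟ₛ zer = yes refl
pos ≟ₛ pos = yes refl
neg ≟ₛ zer = no λ ()
neg ≟ₛ pos = no λ ()
zer ≟ₛ neg = no λ ()
zer ≟ₛ pos = no λ ()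
pos ≟ₛ neg = no λ ()
pos ≟ₛ zer = no λ ()

allSgn : List Sgn
allSgn = neg ∷ zer ∷ pos ∷ []

allSgn-unique : Unique allSgn
allSgn-unique = ((λ ()) ∷ (λ ()) ∷ []) ∷ ((λ ()) ∷ []) ∷ [] ∷ []

∈-allSgn : ∀ s → s ∈ allSgn
∈-allSgn neg = here refl
∈-allSgn zer = there (here refl)
∈-allSgn pos = there (there (here refl))

⟦opp⟧ : ∀ s → ⟦ opp s ⟧ ≡ - ⟦ s ⟧
⟦opp⟧ neg = refl
⟦opp⟧ zer = refl
⟦opp⟧ pos = refl

sgn-neg : ∀ z → sgn (- z) ≡ opp (sgn z)
sgn-neg (+ zero)  = refl
sgn-neg +[1+ _ ]  = refl
sgn-neg -[1+ _ ]  = refl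

⟦⟧+⟦⟧≡0⇒opp : ∀ s s′ → ⟦ s ⟧ + ⟦ s′ ⟧ ≡ + 0 → s′ ≡ opp s
⟦⟧+⟦⟧≡0⇒opp neg pos _ = refl
⟦⟧+⟦⟧≡0⇒opp zer zer _ = refl
⟦⟧+⟦⟧≡0⇒opp pos neg _ = refl

⟦⟧+⟦opp⟧≡0 : ∀ s → ⟦ s ⟧ + ⟦ opp s ⟧ ≡ + 0
⟦⟧+⟦opp⟧≡0 neg = refl
⟦⟧+⟦opp⟧≡0 zer = refl
⟦⟧+⟦opp⟧≡0 pos = refl

0<⇒sgn≡pos : ∀ {z} → + 0 < z → sgn z ≡ pos
0<⇒sgn≡pos {+[1+ _ ]} _ = refl
0<⇒sgn≡pos {+ zero} (+<+ ())

<0⇒sgn≡neg : ∀ {z} → z < + 0 → sgn z ≡ neg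
<0⇒sgn≡neg { -[1+ _ ]} _ = refl
<0⇒sgn≡neg {+ zero} (+<+ ())

sgn≡pos⇒0< : ∀ {z} → sgn z ≡ pos → + 0 < z
sgn≡pos⇒0< {+[1+ _ ]} _ = +<+ (ℕ.s≤s ℕ.z≤n)
sgn≡pos⇒0< {+ zero}   ()
sgn≡pos⇒0< { -[1+ _ ]} ()

sgn≡neg⇒<0 : ∀ {z} → sgn z ≡ neg → z < + 0
sgn≡neg⇒<0 { -[1+ _ ]} _ = -<+
sgn≡neg⇒<0 {+ zero}   ()
sgn≡neg⇒<0 {+[1+ _ ]} ()

sgn≡zer⇒≡0 : ∀ {z} → sgn z ≡ zer → z ≡ + 0
sgn≡zer⇒≡0 {+ zero} _ = refl

-1≤⟦_⟧ : ∀ s → -[1+ 0 ] ≤ᶻ ⟦ s ⟧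
-1≤⟦ neg ⟧ = -≤- ℕ.z≤n
-1≤⟦ zer ⟧ = -≤+
-1≤⟦ pos ⟧ = -≤+

⟦_⟧≤1 : ∀ s → ⟦ s ⟧ ≤ᶻ + 1
⟦ neg ⟧≤1 = -≤+
⟦ zer ⟧≤1 = +≤+ ℕ.z≤n
⟦ pos ⟧≤1 = +≤+ ℕ.≤-refl

flow-sgn : ∀ a b → flow a b ≡ ⟦ sgn (b - a) ⟧
flow-sgn a b with a <? b | b <? a
... | yes a<b | _       = cong ⟦_⟧ (sym (0<⇒sgn≡pos (subst (_< b - a) (ℤ.+-inverseʳ a) (ℤ.+-monoˡ-< (- a) a<b))))
... | no _    | yes b<a = cong ⟦_⟧ (sym (<0⇒sgn≡neg (subst (b - a <_) (ℤ.+-inverseʳ a) (ℤ.+-monoˡ-< (- a) b<a))))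
... | no a≮b  | no b≮a  rewrite ℤ.≤-antisym (ℤ.≮⇒≥ b≮a) (ℤ.≮⇒≥ a≮b) | ℤ.+-inverseʳ b = refl

flow-antisym : ∀ x y → flow y x ≡ - ⟦ sgn (y - x) ⟧
flow-antisym x y = begin
  flow y x              ≡⟨ flow-sgn y x ⟩
  ⟦ sgn (x - y) ⟧        ≡⟨ cong (λ z → ⟦ sgn z ⟧) (swap-sub x y) ⟩
  ⟦ sgn (- (y - x)) ⟧    ≡⟨ cong ⟦_⟧ (sgn-neg (y - x)) ⟩
  ⟦ opp (sgn (y - x)) ⟧  ≡⟨ ⟦opp⟧ (sgn (y - x)) ⟩
  - ⟦ sgn (y - x) ⟧      ∎
  where
  open ≡-Reasoning
  swap-sub : ∀ x y → x - y ≡ - (y - x)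
  swap-sub = solve-∀

-- Diffusion on a path

-- diffuse l C is one step on a path C whose first vertex also has a left edge of sign l;
-- on P_n itself l = zer.
mutual
  diffuse : ∀ {k} → Sgn → Vec ℤ (suc k) → Vec ℤ (suc k)
  diffuse l (x ∷ r) = (x - ⟦ l ⟧ + ⟦ edgeSign x r ⟧) ∷ diffuseFrom x r

  diffuseFrom : ∀ {k} → ℤ → Vec ℤ k → Vec ℤ k
  diffuseFrom x []      = []
  diffuseFrom x (y ∷ r) = diffuse (sgn (y - x)) (y ∷ r)

  edgeSign : ∀ {k} → ℤ → Vec ℤ k → Sgn
  edgeSign x []      = zer
  edgeSign x (y ∷ _) = sgn (y - x)

inflow : ∀ {n} → Vec ℤ n → Fin n → ℤ
inflow C v = ∑ λ u → if pathAdj v u then flow (lookup C v) (lookup C u) else + 0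

foldr-tabulate : ∀ {n} (f : Fin n → ℤ) → foldr _+_ (+ 0) (List.tabulate f) ≡ ∑ f
foldr-tabulate {zero}  f = refl
foldr-tabulate {suc n} f = cong (λ s → f Fin.zero + s) (foldr-tabulate (λ u → f (Fin.suc u)))

lookup-step : ∀ {n} (C : Config n) v → lookup (step (P n) C) v ≡ lookup C v + inflow C v
lookup-step {n} C v = begin
  lookup (step (P n) C) v                                  ≡⟨ Vec.lookup∘tabulate _ v ⟩
  lookup C v + foldr _+_ (+ 0) (map f (allFin n))
    ≡⟨ cong (λ xs → lookup C v + foldr _+_ (+ 0) xs) (List.map-tabulate (λ u → u) f) ⟩
  lookup C v + foldr _+_ (+ 0) (List.tabulate f)           ≡⟨ cong (λ s → lookup C v + s) (foldr-tabulate f) ⟩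
  lookup C v + inflow C v                                  ∎
  where
  open ≡-Reasoning
  f : Fin n → ℤ
  f u = if pathAdj v u then flow (lookup C v) (lookup C u) else + 0

pathAdj-suc : ∀ {n} (v u : Fin n) → pathAdj (Fin.suc v) (Fin.suc u) ≡ pathAdj v u
pathAdj-suc v u = cong₂ _∨_ (≟-suc (toℕ u) (suc (toℕ v))) (≟-suc (toℕ v) (suc (toℕ u)))

pathAdj-suc-suc-zero : ∀ {n} (v : Fin n) → pathAdj (Fin.suc (Fin.suc v)) Fin.zero ≡ false
pathAdj-suc-suc-zero v = dec-false (suc (suc (toℕ v)) ℕ.≟ 1) λ ()

inflow-head : ∀ {k} x (r : Vec ℤ k) → inflow (x ∷ r) Fin.zero ≡ ⟦ edgeSign x r ⟧
inflow-head x []      = refl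
inflow-head {suc k} x (y ∷ r) = begin
  + 0 + (flow x y + ∑ far)   ≡⟨ cong (λ s → + 0 + (flow x y + s)) far≡0 ⟩
  + 0 + (flow x y + + 0)       ≡⟨ trans (ℤ.+-identityˡ _) (ℤ.+-identityʳ _) ⟩
  flow x y                     ≡⟨ flow-sgn x y ⟩
  ⟦ sgn (y - x) ⟧               ∎
  where
  open ≡-Reasoning
  far : Fin k → ℤ
  far u = if pathAdj Fin.zero (Fin.suc (Fin.suc u)) then flow x (lookup r u) else + 0
  far≡0 : ∑ far ≡ + 0
  far≡0 = trans (sum-cong-≗ λ u → cong (λ b → if b then flow x (lookup r u) else + 0)
                   (trans (pathAdj-sym Fin.zero (Fin.suc (Fin.suc u))) (pathAdj-suc-suc-zero u)))
                (sum-replicate-zero k)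

inflow-suc : ∀ {k} x (r : Vec ℤ k) v →
  inflow (x ∷ r) (Fin.suc v) ≡ (if pathAdj (Fin.suc v) Fin.zero then flow (lookup r v) x else + 0) + inflow r v
inflow-suc x r v = cong (λ s → (if pathAdj (Fin.suc v) Fin.zero then flow (lookup r v) x else + 0) + s)
  (sum-cong-≗ λ u → cong (λ b → if b then flow (lookup r v) (lookup r u) else + 0) (pathAdj-suc v u))

inflow-suc-suc : ∀ {k} x y (r : Vec ℤ k) v → inflow (x ∷ y ∷ r) (Fin.suc (Fin.suc v)) ≡ inflow (y ∷ r) (Fin.suc v)
inflow-suc-suc x y r v = begin
  inflow (x ∷ y ∷ r) (Fin.suc (Fin.suc v))   ≡⟨ inflow-suc x (y ∷ r) (Fin.suc v) ⟩
  (if pathAdj (Fin.suc (Fin.suc v)) Fin.zero then flow (lookup r v) x else + 0) + inflow (y ∷ r) (Fin.suc v)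
    ≡⟨ cong (λ b → (if b then flow (lookup r v) x else + 0) + inflow (y ∷ r) (Fin.suc v)) (pathAdj-suc-suc-zero v) ⟩
  + 0 + inflow (y ∷ r) (Fin.suc v)           ≡⟨ ℤ.+-identityˡ _ ⟩
  inflow (y ∷ r) (Fin.suc v)                 ∎
  where open ≡-Reasoning

lookup-diffuse-head : ∀ {k} l x (r : Vec ℤ k) → lookup (diffuse l (x ∷ r)) Fin.zero ≡ x - ⟦ l ⟧ + inflow (x ∷ r) Fin.zero
lookup-diffuse-head l x r = cong (λ s → x - ⟦ l ⟧ + s) (sym (inflow-head x r))

lookup-diffuse-suc : ∀ {k} l x y (r : Vec ℤ k) v →
  lookup (diffuse l (x ∷ y ∷ r)) (Fin.suc v) ≡ lookup (y ∷ r) v + inflow (x ∷ y ∷ r) (Fin.suc v)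
lookup-diffuse-suc l x y r Fin.zero = begin
  y - ⟦ sgn (y - x) ⟧ + ⟦ edgeSign y r ⟧         ≡⟨ ℤ.+-assoc y (- ⟦ sgn (y - x) ⟧) _ ⟩
  y + (- ⟦ sgn (y - x) ⟧ + ⟦ edgeSign y r ⟧)
    ≡⟨ cong₂ (λ a b → y + (a + b)) (sym (flow-antisym x y)) (sym (inflow-head y r)) ⟩
  y + (flow y x + inflow (y ∷ r) Fin.zero)       ≡⟨ cong (λ s → y + s) (sym (inflow-suc x (y ∷ r) Fin.zero)) ⟩
  y + inflow (x ∷ y ∷ r) (Fin.suc Fin.zero)      ∎
  where open ≡-Reasoning
lookup-diffuse-suc l x y (z ∷ r) (Fin.suc v) = begin
  lookup (diffuse (sgn (y - x)) (y ∷ z ∷ r)) (Fin.suc v)          ≡⟨ lookup-diffuse-suc (sgn (y - x)) y z r v ⟩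
  lookup (z ∷ r) v + inflow (y ∷ z ∷ r) (Fin.suc v)
    ≡⟨ cong (λ s → lookup (z ∷ r) v + s) (sym (inflow-suc-suc x y (z ∷ r) v)) ⟩
  lookup (z ∷ r) v + inflow (x ∷ y ∷ z ∷ r) (Fin.suc (Fin.suc v)) ∎
  where open ≡-Reasoning

lookup-diffuse-zer : ∀ {k} (C : Vec ℤ (suc k)) v → lookup (diffuse zer C) v ≡ lookup C v + inflow C v
lookup-diffuse-zer (x ∷ r)     Fin.zero    =
  trans (lookup-diffuse-head zer x r) (cong (_+ inflow (x ∷ r) Fin.zero) (ℤ.+-identityʳ x))
lookup-diffuse-zer (x ∷ y ∷ r) (Fin.suc v) = lookup-diffuse-suc zer x y r v

step-path : ∀ {k} (C : Config (suc k)) → step (P (suc k)) C ≡ diffuse zer C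
step-path {k} C = begin
  step (P (suc k)) C                      ≡⟨ Vec.tabulate∘lookup _ ⟨
  tabulate (lookup (step (P (suc k)) C))  ≡⟨ Vec.tabulate-cong (λ v → trans (lookup-step C v) (sym (lookup-diffuse-zer C v))) ⟩
  tabulate (lookup (diffuse zer C))       ≡⟨ Vec.tabulate∘lookup _ ⟩
  diffuse zer C                           ∎
  where open ≡-Reasoning

step²-path : ∀ {k} (C : Config (suc k)) → step (P (suc k)) (step (P (suc k)) C) ≡ diffuse zer (diffuse zer C)
step²-path C = trans (step-path _) (cong (diffuse zer) (step-path C))

-- Period two on a path

-- The difference d across an edge whose neighbouring edges have signs l and t
-- becomes  gapAfterStep l d t  after one step.
gapAfterStep : Sgn → ℤ → Sgn → ℤ
gapAfterStep l d t = d - ⟦ sgn d ⟧ - ⟦ sgn d ⟧ + ⟦ l ⟧ + ⟦ t ⟧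

Flips : Sgn → ℤ → Sgn → Set
Flips l d t = sgn (gapAfterStep l d t) ≡ opp (sgn d)

AllFlip : ∀ {k} → Sgn → Vec ℤ (suc k) → Set
AllFlip l (x ∷ [])    = ⊤
AllFlip l (x ∷ y ∷ r) = Flips l (y - x) (edgeSign y r) × AllFlip (sgn (y - x)) (y ∷ r)

diffuse-twice : ∀ {k} l x y (r : Vec ℤ k) →
  let σ = sgn (y - x); σ′ = sgn (gapAfterStep l (y - x) (edgeSign y r)) in
  diffuse (opp l) (diffuse l (x ∷ y ∷ r)) ≡ (x + (⟦ σ ⟧ + ⟦ σ′ ⟧)) ∷ diffuse σ′ (diffuse σ (y ∷ r))
diffuse-twice l x y r = begin
  first (sgn (y - ⟦ σ ⟧ + ⟦ t ⟧ - (x - ⟦ l ⟧ + ⟦ σ ⟧)))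
    ≡⟨ cong (λ d → first (sgn d)) (gap-identity x y ⟦ σ ⟧ ⟦ l ⟧ ⟦ t ⟧) ⟩
  first σ′
    ≡⟨ cong (_∷ diffuse σ′ (diffuse σ (y ∷ r)))
         (trans (cong (λ s → x - ⟦ l ⟧ + ⟦ σ ⟧ - s + ⟦ σ′ ⟧) (⟦opp⟧ l)) (head-identity x ⟦ l ⟧ ⟦ σ ⟧ ⟦ σ′ ⟧)) ⟩
  (x + (⟦ σ ⟧ + ⟦ σ′ ⟧)) ∷ diffuse σ′ (diffuse σ (y ∷ r)) ∎
  where
  open ≡-Reasoning
  σ = sgn (y - x)
  t = edgeSign y r
  σ′ = sgn (gapAfterStep l (y - x) t)
  first : Sgn → Vec ℤ _
  first s = (x - ⟦ l ⟧ + ⟦ σ ⟧ - ⟦ opp l ⟧ + ⟦ s ⟧) ∷ diffuse s (diffuse σ (y ∷ r))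
  head-identity : ∀ x l s s′ → x - l + s - - l + s′ ≡ x + (s + s′)
  head-identity = solve-∀
  gap-identity : ∀ x y s l t → (y - s + t) - (x - l + s) ≡ y - x - s - s + l + t
  gap-identity = solve-∀

diffuse²≡id⇒AllFlip : ∀ {k} l (C : Vec ℤ (suc k)) → diffuse (opp l) (diffuse l C) ≡ C → AllFlip l C
diffuse²≡id⇒AllFlip l (x ∷ [])    _ = tt
diffuse²≡id⇒AllFlip l (x ∷ y ∷ r) e =
  flips , diffuse²≡id⇒AllFlip σ (y ∷ r) (subst (λ s → diffuse s (diffuse σ (y ∷ r)) ≡ y ∷ r) flips (Vec.∷-injectiveʳ e′))
  where
  σ = sgn (y - x)
  e′ = trans (sym (diffuse-twice l x y r)) e
  flips : Flips l (y - x) (edgeSign y r)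
  flips = ⟦⟧+⟦⟧≡0⇒opp σ _ (x+a≡x⇒a≡0 x _ (Vec.∷-injectiveˡ e′))

AllFlip⇒diffuse²≡id : ∀ {k} l (C : Vec ℤ (suc k)) → AllFlip l C → diffuse (opp l) (diffuse l C) ≡ C
AllFlip⇒diffuse²≡id l (x ∷ [])    _ =
  cong (_∷ []) (trans (cong (λ s → x - ⟦ l ⟧ + + 0 - s + + 0) (⟦opp⟧ l)) (identity x ⟦ l ⟧))
  where
  identity : ∀ x l → x - l + + 0 - - l + + 0 ≡ x
  identity = solve-∀
AllFlip⇒diffuse²≡id l (x ∷ y ∷ r) (flips , rest) = begin
  diffuse (opp l) (diffuse l (x ∷ y ∷ r))                   ≡⟨ diffuse-twice l x y r ⟩
  (x + (⟦ σ ⟧ + ⟦ σ′ ⟧)) ∷ diffuse σ′ (diffuse σ (y ∷ r))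
    ≡⟨ cong (λ s → (x + (⟦ σ ⟧ + ⟦ s ⟧)) ∷ diffuse s (diffuse σ (y ∷ r))) flips ⟩
  (x + (⟦ σ ⟧ + ⟦ opp σ ⟧)) ∷ diffuse (opp σ) (diffuse σ (y ∷ r))
    ≡⟨ cong₂ _∷_ (trans (cong (λ s → x + s) (⟦⟧+⟦opp⟧≡0 σ)) (ℤ.+-identityʳ x)) (AllFlip⇒diffuse²≡id σ (y ∷ r) rest) ⟩
  x ∷ y ∷ r                                                 ∎
  where
  open ≡-Reasoning
  σ = sgn (y - x)
  σ′ = sgn (gapAfterStep l (y - x) (edgeSign y r))

Flips-flat : ∀ t → Flips zer (+ 0) t → t ≡ zer
Flips-flat zer _ = refl

diffuse-fixed : ∀ {k} x (r : Vec ℤ k) → AllFlip zer (x ∷ r) → edgeSign x r ≡ zer → diffuse zer (x ∷ r) ≡ x ∷ r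
diffuse-fixed x []      _            _     = cong (_∷ []) (trans (ℤ.+-identityʳ _) (ℤ.+-identityʳ x))
diffuse-fixed x (y ∷ r) (flips , rest) σ≡zer = cong₂ _∷_
  (trans (cong (λ s → x - + 0 + ⟦ s ⟧) σ≡zer) (trans (ℤ.+-identityʳ _) (ℤ.+-identityʳ x)))
  (trans (cong (λ s → diffuse s (y ∷ r)) σ≡zer)
    (diffuse-fixed y r (subst (λ s → AllFlip s (y ∷ r)) σ≡zer rest)
      (Flips-flat (edgeSign y r) (subst (λ d → Flips zer d (edgeSign y r)) (sgn≡zer⇒≡0 σ≡zer) flips))))

diffuse-fixed⇒edgeSign≡zer : ∀ {k} x (r : Vec ℤ k) → diffuse zer (x ∷ r) ≡ x ∷ r → edgeSign x r ≡ zer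
diffuse-fixed⇒edgeSign≡zer x r e =
  ⟦⟧+⟦⟧≡0⇒opp zer _ (x+a≡x⇒a≡0 x _ (trans (sym (ℤ.+-assoc x (+ 0) _)) (Vec.∷-injectiveˡ e)))

IsP2-path⇔ : ∀ {k} x (r : Vec ℤ k) → IsP2 (P (suc k)) (x ∷ r) ⇔ (AllFlip zer (x ∷ r) × edgeSign x r ≢ zer)
IsP2-path⇔ x r = mk⇔
  (λ (returns , moves) → let flips = diffuse²≡id⇒AllFlip zer (x ∷ r) (trans (sym (step²-path (x ∷ r))) returns) in
     flips , λ e → moves (trans (step-path (x ∷ r)) (diffuse-fixed x r flips e)))
  (λ (flips , moving) →
     trans (step²-path (x ∷ r)) (AllFlip⇒diffuse²≡id zer (x ∷ r) flips) ,
     λ e → moving (diffuse-fixed⇒edgeSign≡zer x r (trans (sym (step-path (x ∷ r))) e)))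

single-vertex-not-p2 : ∀ (C : Config 1) → ¬ IsP2 (P 1) C
single-vertex-not-p2 (x ∷ []) p2 = proj₂ (Equivalence.to (IsP2-path⇔ x []) p2) refl

-- Enumeration

window : List ℤ
window = -[1+ 2 ] ∷ -[1+ 1 ] ∷ -[1+ 0 ] ∷ + 0 ∷ + 1 ∷ + 2 ∷ + 3 ∷ []

-- For |d| ≥ 4 the edge itself moves d by 2 towards 0 and its neighbours move it by at most
-- 2 back, so the sign of d survives the step.
Flips⇒∈window : ∀ l d t → Flips l d t → d ∈ window
Flips⇒∈window l -[1+ 2 ] t _ = here refl
Flips⇒∈window l -[1+ 1 ] t _ = there (here refl)
Flips⇒∈window l -[1+ 0 ] t _ = there (there (here refl))
Flips⇒∈window l (+ 0)    t _ = there (there (there (here refl)))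
Flips⇒∈window l (+ 1)    t _ = there (there (there (there (here refl))))
Flips⇒∈window l (+ 2)    t _ = there (there (there (there (there (here refl)))))
Flips⇒∈window l (+ 3)    t _ = there (there (there (there (there (there (here refl))))))
Flips⇒∈window l +[1+ suc (suc (suc n)) ] t flips = ⊥-elim (ℤ.≤⇒≯ 0≤gap (sgn≡neg⇒<0 flips))
  where
  0≤gap : + 0 ≤ᶻ + (2 ℕ.+ n) + ⟦ l ⟧ + ⟦ t ⟧
  0≤gap = ℤ.+-mono-≤ (ℤ.+-mono-≤ (+≤+ (ℕ.m≤m+n 2 n)) -1≤⟦ l ⟧) -1≤⟦ t ⟧
Flips⇒∈window l -[1+ suc (suc (suc n)) ] t flips = ⊥-elim (ℤ.≤⇒≯ gap≤0 (sgn≡pos⇒0< flips))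
  where
  gap≤0 : -[1+ suc n ] + ⟦ l ⟧ + ⟦ t ⟧ ≤ᶻ + 0
  gap≤0 = ℤ.+-mono-≤ (ℤ.+-mono-≤ (-≤- (ℕ.s≤s ℕ.z≤n)) ⟦ l ⟧≤1) ⟦ t ⟧≤1

window-unique : Unique window
window-unique = from-yes (unique? window)

Admissible : Sgn → Sgn → Sgn → ℤ → Set
Admissible l s t d = sgn d ≡ s × Flips l d t

admissible? : ∀ l s t → Decidable (Admissible l s t)
admissible? l s t d = (sgn d ≟ₛ s) ×-dec (sgn (gapAfterStep l d t) ≟ₛ opp (sgn d))

allowed : Sgn → Sgn → Sgn → List ℤ
allowed l s t = filter (admissible? l s t) window

∈-allowed⁻ : ∀ l s t {d} → d ∈ allowed l s t → Admissible l s t d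
∈-allowed⁻ l s t = proj₂ ∘ ∈-filter⁻ (admissible? l s t) {xs = window}

∈-allowed⁺ : ∀ {l t d} → Flips l d t → d ∈ allowed l (sgn d) t
∈-allowed⁺ {l} {t} {d} flips = ∈-filter⁺ (admissible? l (sgn d) t) (Flips⇒∈window l d t flips) (refl , flips)

allowed-unique : ∀ l s t → Unique (allowed l s t)
allowed-unique l s t = Unique.filter⁺ (admissible? l s t) window-unique

Flipping : ∀ {k} → Sgn → Sgn → ℤ → Vec ℤ (suc k) → Set
Flipping l s c (x ∷ r) = x ≡ c × edgeSign x r ≡ s × AllFlip l (x ∷ r)

mutual
  flipping : (k : ℕ) → Sgn → Sgn → ℤ → List (Vec ℤ (2 ℕ.+ k))
  flipping zero    l s c = map (λ d → c ∷ c + d ∷ []) (allowed l s zer)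
  flipping (suc k) l s c = concatMap (flippingVia k l s c) allSgn

  flippingVia : (k : ℕ) → Sgn → Sgn → ℤ → Sgn → List (Vec ℤ (3 ℕ.+ k))
  flippingVia k l s c t = concatMap (λ d → map (c ∷_) (flipping k s t (c + d))) (allowed l s t)

∈-flipping-suc⁻ : ∀ k l s c {C} → C ∈ flipping (suc k) l s c →
  ∃ λ t → ∃ λ d → d ∈ allowed l s t × ∃ λ C′ → C′ ∈ flipping k s t (c + d) × C ≡ c ∷ C′
∈-flipping-suc⁻ k l s c C∈
  with t , _ , C∈via ← find (∈-concatMap⁻ (flippingVia k l s c) {xs = allSgn} C∈)
  with d , d∈ , C∈map ← find (∈-concatMap⁻ (λ d → map (c ∷_) (flipping k s t (c + d))) {xs = allowed l s t} C∈via)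
  with C′ , C′∈ , refl ← ∈-map⁻ (c ∷_) C∈map
  = t , d , d∈ , C′ , C′∈ , refl

∈-flipping-suc⁺ : ∀ k l s c {t d C′} →
  d ∈ allowed l s t → C′ ∈ flipping k s t (c + d) → c ∷ C′ ∈ flipping (suc k) l s c
∈-flipping-suc⁺ k l s c {t} d∈ C′∈ =
  ∈-concatMap⁺ (flippingVia k l s c) (lose (∈-allSgn t)
    (∈-concatMap⁺ (λ d → map (c ∷_) (flipping k s t (c + d))) (lose d∈ (∈-map⁺ (c ∷_) C′∈))))

Flipping-cons : ∀ {k l s t c d} (C′ : Vec ℤ (2 ℕ.+ k)) →
  Admissible l s t d → Flipping s t (c + d) C′ → Flipping l s c (c ∷ C′)
Flipping-cons {c = c} {d} (_ ∷ _ ∷ _) (refl , flips) (refl , refl , rest) rewrite +-sub-cancel c d = refl , refl , flips , rest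

∈-flipping⁻ : ∀ k l s c C → C ∈ flipping k l s c → Flipping l s c C
∈-flipping⁻ zero l s c C C∈
  with d , d∈ , refl ← ∈-map⁻ (λ d → c ∷ c + d ∷ []) C∈
  with refl , flips ← ∈-allowed⁻ l s zer d∈
  rewrite +-sub-cancel c d = refl , refl , flips , tt
∈-flipping⁻ (suc k) l s c C C∈
  with t , d , d∈ , C′ , C′∈ , refl ← ∈-flipping-suc⁻ k l s c C∈
  = Flipping-cons C′ (∈-allowed⁻ l s t d∈) (∈-flipping⁻ k s t (c + d) C′ C′∈)

∈-flipping⁺ : ∀ k l s c C → Flipping l s c C → C ∈ flipping k l s c
∈-flipping⁺ zero l _ _ (x ∷ y ∷ []) (refl , refl , flips , _) =
  subst (λ z → x ∷ z ∷ [] ∈ flipping zero l (sgn (y - x)) x) (+-sub-inverse x y)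
    (∈-map⁺ (λ d → x ∷ x + d ∷ []) (∈-allowed⁺ {t = zer} flips))
∈-flipping⁺ (suc k) l _ _ (x ∷ y ∷ z ∷ r) (refl , refl , flips , rest) =
  ∈-flipping-suc⁺ k l (sgn (y - x)) x (∈-allowed⁺ {t = sgn (z - y)} flips)
    (subst (λ w → y ∷ z ∷ r ∈ flipping k (sgn (y - x)) (sgn (z - y)) w) (sym (+-sub-inverse x y))
      (∈-flipping⁺ k (sgn (y - x)) (sgn (z - y)) y (y ∷ z ∷ r) (refl , refl , rest)))

firstGap : ∀ {k} → Vec ℤ (2 ℕ.+ k) → ℤ
firstGap (x ∷ y ∷ _) = y - x

secondSign : ∀ {k} → Vec ℤ (3 ℕ.+ k) → Sgn
secondSign (_ ∷ y ∷ z ∷ _) = sgn (z - y)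

firstGap-cons : ∀ k l s c d {C′} → C′ ∈ flipping k l s (c + d) → firstGap (c ∷ C′) ≡ d
firstGap-cons k l s c d {y ∷ _} C′∈ with refl , _ ← ∈-flipping⁻ k l s (c + d) (y ∷ _) C′∈ = +-sub-cancel c d

flipping-unique : ∀ k l s c → Unique (flipping k l s c)
flipping-unique zero l s c = Unique.map⁺ gap-injective (allowed-unique l s zer)
  where
  gap-injective : ∀ {d d′} → c ∷ c + d ∷ [] ≡ c ∷ c + d′ ∷ [] → d ≡ d′
  gap-injective {d} {d′} e = trans (sym (+-sub-cancel c d)) (trans (cong firstGap e) (+-sub-cancel c d′))
flipping-unique (suc k) l s c = unique-concatMap secondSign allSgn-unique via-unique via-key
  where
  via-unique : ∀ t → Unique (flippingVia k l s c t)
  via-unique t = unique-concatMap firstGap (allowed-unique l s t)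
    (λ d → Unique.map⁺ Vec.∷-injectiveʳ (flipping-unique k s t (c + d)))
    (λ {d} C∈ → let C′ , C′∈ , C≡ = ∈-map⁻ (c ∷_) C∈ in trans (cong firstGap C≡) (firstGap-cons k s t c d C′∈))
  via-key : ∀ {t C} → C ∈ flippingVia k l s c t → secondSign C ≡ t
  via-key {t} C∈
    with d , _ , C∈map ← find (∈-concatMap⁻ (λ d → map (c ∷_) (flipping k s t (c + d))) {xs = allowed l s t} C∈)
    with y ∷ z ∷ r , C′∈ , refl ← ∈-map⁻ (c ∷_) C∈map
    with _ , t≡ , _ ← ∈-flipping⁻ k s t (c + d) (y ∷ z ∷ r) C′∈
    = t≡

p2List : ∀ k → List (Config (2 ℕ.+ k))
p2List k = flipping k zer pos (+ 0) ++ flipping k zer neg (+ 0)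

p2List-unique : ∀ k → Unique (p2List k)
p2List-unique k = Unique.++⁺ (flipping-unique k zer pos (+ 0)) (flipping-unique k zer neg (+ 0)) disjoint
  where
  disjoint : ∀ {C} → ¬ (C ∈ flipping k zer pos (+ 0) × C ∈ flipping k zer neg (+ 0))
  disjoint {x ∷ r} (C∈₁ , C∈₂)
    with _ , e₁ , _ ← ∈-flipping⁻ k zer pos (+ 0) (x ∷ r) C∈₁
    with _ , e₂ , _ ← ∈-flipping⁻ k zer neg (+ 0) (x ∷ r) C∈₂
    with () ← trans (sym e₁) e₂

p2List-sound : ∀ k → All (λ C → IsP2 (P (2 ℕ.+ k)) C × head C ≡ + 0) (p2List k)
p2List-sound k = All.tabulate λ {C} C∈ → [ flipping⇒p2 pos (λ ()) C , flipping⇒p2 neg (λ ()) C ]′ (∈-++⁻ _ C∈)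
  where
  flipping⇒p2 : ∀ s → s ≢ zer → ∀ C → C ∈ flipping k zer s (+ 0) → IsP2 (P (2 ℕ.+ k)) C × head C ≡ + 0
  flipping⇒p2 s s≢zer (x ∷ r) C∈ with x≡0 , e , flips ← ∈-flipping⁻ k zer s (+ 0) (x ∷ r) C∈ =
    Equivalence.from (IsP2-path⇔ x r) (flips , λ e′ → s≢zer (trans (sym e) e′)) , x≡0

p2List-complete : ∀ k C → IsP2 (P (2 ℕ.+ k)) C → head C ≡ + 0 → C ∈ p2List k
p2List-complete k (x ∷ r) p2 x≡0 = place (edgeSign x r) refl moving
  where
  flips = proj₁ (Equivalence.to (IsP2-path⇔ x r) p2)
  moving = proj₂ (Equivalence.to (IsP2-path⇔ x r) p2)
  place : ∀ s → edgeSign x r ≡ s → s ≢ zer → x ∷ r ∈ p2List k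
  place pos e _ = ∈-++⁺ˡ (∈-flipping⁺ k zer pos (+ 0) (x ∷ r) (x≡0 , e , flips))
  place neg e _ = ∈-++⁺ʳ _ (∈-flipping⁺ k zer neg (+ 0) (x ∷ r) (x≡0 , e , flips))
  place zer _ s≢zer = ⊥-elim (s≢zer refl)

-- Counting

count : ℕ → Sgn → Sgn → ℕ
count zero    l s = length (allowed l s zer)
count (suc k) l s = sum (map (λ t → length (allowed l s t) ℕ.* count k s t) allSgn)

length-flipping : ∀ k l s c → length (flipping k l s c) ≡ count k l s
length-flipping zero    l s c = List.length-map _ (allowed l s zer)
length-flipping (suc k) l s c = begin
  length (concatMap (flippingVia k l s c) allSgn)   ≡⟨ length-concatMap (flippingVia k l s c) allSgn ⟩
  sum (map (length ∘ flippingVia k l s c) allSgn)   ≡⟨ cong sum (List.map-cong length-via allSgn) ⟩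
  count (suc k) l s                                 ∎
  where
  open ≡-Reasoning
  length-via : ∀ t → length (flippingVia k l s c t) ≡ length (allowed l s t) ℕ.* count k s t
  length-via t = trans (length-concatMap _ (allowed l s t)) (sum-map-const (allowed l s t) λ d →
    trans (List.length-map (c ∷_) (flipping k s t (c + d))) (length-flipping k s t (c + d)))

mirror : (Sgn → Sgn → ℕ) → Sgn → Sgn → ℕ
mirror f l s = f l s ℕ.+ f (opp l) (opp s)

T : ℕ → ℕ
T zero          = 0
T (suc zero)    = 0
T (suc (suc k)) = mirror (count k) zer pos

count-p2 : ∀ m → CountP2 m (T (suc m))
count-p2 zero    = [] , [] , [] , (λ C p2 _ → ⊥-elim (single-vertex-not-p2 C p2)) , refl
count-p2 (suc k) = p2List k , p2List-unique k , p2List-sound k , p2List-complete k ,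
  trans (List.length-++ (flipping k zer pos (+ 0)))
        (cong₂ ℕ._+_ (length-flipping k zer pos (+ 0)) (length-flipping k zer neg (+ 0)))

turns : ℕ → ℕ
turns k = mirror (count k) pos neg

-- In the identities below the coefficients are the lengths of the lists  allowed l s t.
mirror-zer-pos : ∀ k → mirror (count (suc k)) zer pos ≡ mirror (count k) pos zer ℕ.+ 2 ℕ.* turns k
mirror-zer-pos k = identity (count k pos neg) (count k pos zer) (count k pos pos) (count k neg neg) (count k neg zer) (count k neg pos)
  where
  identity : ∀ pn pz pp nn nz np →
    (2 ℕ.* pn ℕ.+ (1 ℕ.* pz ℕ.+ (0 ℕ.* pp ℕ.+ 0))) ℕ.+ (0 ℕ.* nn ℕ.+ (1 ℕ.* nz ℕ.+ (2 ℕ.* np ℕ.+ 0)))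
      ≡ (pz ℕ.+ nz) ℕ.+ 2 ℕ.* (pn ℕ.+ np)
  identity = ℕ-solve-∀

mirror-pos-zer : ∀ k → mirror (count (suc k)) pos zer ≡ mirror (count k) zer pos
mirror-pos-zer k = identity (count k zer neg) (count k zer zer) (count k zer pos)
  where
  identity : ∀ zn zz zp →
    (1 ℕ.* zn ℕ.+ (0 ℕ.* zz ℕ.+ (0 ℕ.* zp ℕ.+ 0))) ℕ.+ (0 ℕ.* zn ℕ.+ (0 ℕ.* zz ℕ.+ (1 ℕ.* zp ℕ.+ 0)))
      ≡ zp ℕ.+ zn
  identity = ℕ-solve-∀

mirror-pos-pos : ∀ k → mirror (count (suc k)) pos pos ≡ turns k
mirror-pos-pos k = identity (count k pos neg) (count k pos zer) (count k pos pos) (count k neg neg) (count k neg zer) (count k neg pos)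
  where
  identity : ∀ pn pz pp nn nz np →
    (1 ℕ.* pn ℕ.+ (0 ℕ.* pz ℕ.+ (0 ℕ.* pp ℕ.+ 0))) ℕ.+ (0 ℕ.* nn ℕ.+ (0 ℕ.* nz ℕ.+ (1 ℕ.* np ℕ.+ 0)))
      ≡ pn ℕ.+ np
  identity = ℕ-solve-∀

mirror-pos-neg : ∀ k → turns (suc k) ≡ mirror (count k) pos pos ℕ.+ 2 ℕ.* mirror (count k) pos zer ℕ.+ 3 ℕ.* turns k
mirror-pos-neg k = identity (count k pos neg) (count k pos zer) (count k pos pos) (count k neg neg) (count k neg zer) (count k neg pos)
  where
  identity : ∀ pn pz pp nn nz np →
    (1 ℕ.* nn ℕ.+ (2 ℕ.* nz ℕ.+ (3 ℕ.* np ℕ.+ 0))) ℕ.+ (3 ℕ.* pn ℕ.+ (2 ℕ.* pz ℕ.+ (1 ℕ.* pp ℕ.+ 0)))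
      ≡ (pp ℕ.+ nn) ℕ.+ 2 ℕ.* (pz ℕ.+ nz) ℕ.+ 3 ℕ.* (pn ℕ.+ np)
  identity = ℕ-solve-∀

T-step : ∀ k → T (3 ℕ.+ k) ≡ T (1 ℕ.+ k) ℕ.+ 2 ℕ.* turns k
T-step zero    = refl
T-step (suc k) = trans (mirror-zer-pos (suc k)) (cong (ℕ._+ 2 ℕ.* turns (suc k)) (mirror-pos-zer k))

turns-step : ∀ k → turns (2 ℕ.+ k) ≡ turns k ℕ.+ 2 ℕ.* T (2 ℕ.+ k) ℕ.+ 3 ℕ.* turns (1 ℕ.+ k)
turns-step k = trans (mirror-pos-neg (suc k))
  (cong₂ (λ a b → a ℕ.+ 2 ℕ.* b ℕ.+ 3 ℕ.* turns (suc k)) (mirror-pos-pos k) (mirror-pos-zer k))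

T-recurrence : ∀ j → T (5 ℕ.+ j) ℕ.+ T (1 ℕ.+ j) ≡ 3 ℕ.* T (4 ℕ.+ j) ℕ.+ 2 ℕ.* T (3 ℕ.+ j) ℕ.+ T (2 ℕ.+ j)
T-recurrence j = begin
  T (5 ℕ.+ j) ℕ.+ x
    ≡⟨ cong (ℕ._+ x) (T-step (2 ℕ.+ j)) ⟩
  T (3 ℕ.+ j) ℕ.+ 2 ℕ.* turns (2 ℕ.+ j) ℕ.+ x
    ≡⟨ cong₂ (λ a b → a ℕ.+ 2 ℕ.* b ℕ.+ x) (T-step j) (turns-step j) ⟩
  x ℕ.+ 2 ℕ.* p ℕ.+ 2 ℕ.* (p ℕ.+ 2 ℕ.* y ℕ.+ 3 ℕ.* q) ℕ.+ x
    ≡⟨ identity x y p q ⟩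
  3 ℕ.* (y ℕ.+ 2 ℕ.* q) ℕ.+ 2 ℕ.* (x ℕ.+ 2 ℕ.* p) ℕ.+ y
    ≡⟨ cong₂ (λ a b → 3 ℕ.* a ℕ.+ 2 ℕ.* b ℕ.+ y) (T-step (1 ℕ.+ j)) (T-step j) ⟨
  3 ℕ.* T (4 ℕ.+ j) ℕ.+ 2 ℕ.* T (3 ℕ.+ j) ℕ.+ y
    ∎
  where
  open ≡-Reasoning
  x = T (1 ℕ.+ j)
  y = T (2 ℕ.+ j)
  p = turns j
  q = turns (1 ℕ.+ j)
  identity : ∀ x y p q → x ℕ.+ 2 ℕ.* p ℕ.+ 2 ℕ.* (p ℕ.+ 2 ℕ.* y ℕ.+ 3 ℕ.* q) ℕ.+ x
                       ≡ 3 ℕ.* (y ℕ.+ 2 ℕ.* q) ℕ.+ 2 ℕ.* (x ℕ.+ 2 ℕ.* p) ℕ.+ y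
  identity = ℕ-solve-∀

+-recurrence : ∀ {a b c d e} → a ℕ.+ e ≡ 3 ℕ.* b ℕ.+ 2 ℕ.* c ℕ.+ d →
  + a ≡ + 3 * + b + + 2 * + c + + d - + e
+-recurrence {a} {b} {c} {d} {e} eq = begin
  + a                                  ≡⟨ shift (+ a) (+ e) ⟩
  + (a ℕ.+ e) - + e                    ≡⟨ cong (λ n → + n - + e) eq ⟩
  + (3 ℕ.* b) + + (2 ℕ.* c) + + d - + e ≡⟨ cong (λ z → z + + d - + e) (cong₂ _+_ (ℤ.pos-* 3 b) (ℤ.pos-* 2 c)) ⟩
  + 3 * + b + + 2 * + c + + d - + e    ∎
  where
  open ≡-Reasoning
  shift : ∀ x y → x ≡ x + y - y
  shift = solve-∀

T-recurrence-ℤ : ∀ n → 5 ≤ n →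
  + T n ≡ + 3 * + T (n ℕ.∸ 1) + + 2 * + T (n ℕ.∸ 2) + + T (n ℕ.∸ 3) - + T (n ℕ.∸ 4)
T-recurrence-ℤ n 5≤n with j , refl ← ℕ.m≤n⇒∃[o]m+o≡n 5≤n =
  +-recurrence {b = T (4 ℕ.+ j)} {T (3 ℕ.+ j)} {T (2 ℕ.+ j)} {T (1 ℕ.+ j)} (T-recurrence j)

theorem6 : Σ (ℕ → ℕ) λ T →
    (∀ m → CountP2 m (T (suc m)))
    × T 1 ≡ 0 × T 2 ≡ 2 × T 3 ≡ 8 × T 4 ≡ 26
    × (∀ n → 5 ≤ n →
         + T n ≡ + 3 * + T (n Data.Nat.∸ 1) + + 2 * + T (n Data.Nat.∸ 2)
                 + + T (n Data.Nat.∸ 3) - + T (n Data.Nat.∸ 4))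
theorem6 = T , count-p2 , refl , refl , refl , refl , T-recurrence-ℤ
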